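{- For $n\ge 1$ let $R_n(x)=\sum_{\sigma\in\mathcal{S}_n} x^{\overleftarrow{des}_E(\sigma)}$. Then (1) $R_1(x)=1$ and $R_2(x)=1+x$; (2) for all $n\ge 1$, $R_{2n+1}(x)=\Delta_{2n}(R_{2n}(x))$; (3) for all $n\ge 1$, $R_{2n+2}(x)=\Gamma_{2n+1}(R_{2n+1}(x))$, where $\Delta_{2n}$ is the linear operator on polynomials in $x$ sending $x^k$ to $k x^{k-1}+(2n+1-k)x^k$, and $\Gamma_{2n+1}$ is the linear operator sending $x^k$ to $(k+1)x^k+(2n+1-k)x^{k+1}$.
   Context: $\mathcal{S}_n$ denotes the set of permutations $\sigma=\sigma_1\sigma_2\cdots\sigma_n$ of $\{1,\dots,n\}$. For such $\sigma$, $\overleftarrow{des}_E(\sigma)$ is the number of indices $i\in\{1,\dots,n-1\}$ such that $\sigma_i>\sigma_{i+1}$ and $\sigma_i$ is even. -}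

module Defs where

open import Data.Nat using (ℕ; zero; suc; _≟_)
open import Data.Nat.Properties using ()
open import Data.Bool using (Bool; true; false; if_then_else_)
open import Data.Fin using (Fin; toℕ)
import Data.Fin.Properties as FinP
open import Data.Vec using (Vec; []; _∷_; toList)
open import Data.List using (List; []; _∷_; [_]; map; concatMap; allFin; filter; length)
open import Data.Integer using (ℤ; +_; _-_; _*_) renaming (_+_ to _+ℤ_)
import Data.Integer as ℤ
open import Data.Nat.Base using (_<ᵇ_; _≡ᵇ_; _%_)
open import Relation.Nullary.Decidable using (_×-dec_)
open import Data.List.Relation.Unary.Unique.Propositional using (Unique)
import Data.List.Relation.Unary.Unique.DecPropositional as UDec

allVecs : (n m : ℕ) → List (Vec (Fin n) m)
allVecs n zero = [ [] ]
allVecs n (suc m) = concatMap (λ v → map (_∷ v) (allFin n)) (allVecs n m)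

-- A permutation σ = σ₁…σₙ of {1,…,n} is encoded as a vector of length n over
-- Fin n (entry i stands for the value i+1) with pairwise distinct entries.
IsPerm : {n : ℕ} → Vec (Fin n) n → Set
IsPerm v = Unique (toList v)

val : {n : ℕ} → Fin n → ℕ
val i = suc (toℕ i)

desEList : {n : ℕ} → List (Fin n) → ℕ
desEList [] = 0
desEList (a ∷ []) = 0
desEList (a ∷ b ∷ w) =
  (if (val b <ᵇ val a) Data.Bool.∧ ((val a % 2) ≡ᵇ 0) then 1 else 0) Data.Nat.+ desEList (b ∷ w)

desE : {n : ℕ} → Vec (Fin n) n → ℕ
desE v = desEList (toList v)

-- Polynomials in x with integer coefficients, as coefficient sequences
-- (p k = coefficient of x^k); equality of polynomials is pointwise equality.
Poly : Set
Poly = ℕ → ℤ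

R : ℕ → Poly
R n k = + length (filter (λ v → UDec.unique? FinP._≟_ (toList v) ×-dec (desE v ≟ k)) (allVecs n n))

-- Δ_m : x^k ↦ k x^{k-1} + (m+1-k) x^k  (used with m = 2n)
Δ : ℕ → Poly → Poly
Δ m p j = (+ suc j) * p (suc j) +ℤ ((+ suc m) - (+ j)) * p j

-- Γ_m : x^k ↦ (k+1) x^k + (m-k) x^{k+1}  (used with m = 2n+1)
Γ : ℕ → Poly → Poly
Γ m p zero = (+ 1) * p zero
Γ m p (suc j) = (+ suc (suc j)) * p (suc j) +ℤ ((+ m) - (+ j)) * p j

one : Poly
one zero = + 1
one (suc _) = + 0

onePlusX : Poly
onePlusX zero = + 1
onePlusX (suc zero) = + 1
onePlusX (suc (suc _)) = + 0

module Submission where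

-- Every permutation of {1,…,m+1} arises exactly once by inserting m+1 into a permutation τ of
-- {1,…,m}. Put D = des_E τ + [m+1 even]. Placing m+1 last loses its potential even descent;
-- placing it between two letters destroys the even descent between them, if any; placing it
-- first loses nothing. So D of the m+1 insertions have D − 1 even descents and the other m+1−D
-- have D, i.e. the insertions contribute Δ_m(x^D). For m+1 odd D = des_E τ, and for m+1 even
-- Δ_m(x^(d+1)) = Γ_m(x^d) with d = des_E τ; by linearity the contributions sum to Δ_m(R_m)
-- resp. Γ_m(R_m).

open import Defs
open import Data.Nat
  using (ℕ; zero; suc; _+_; _*_; _∸_; _≤_; _<_; _≟_; _<ᵇ_; _≡ᵇ_; _%_; z≤n; s≤s)
open import Data.Nat.Properties
  using ( +-comm; *-comm; +-assoc; +-suc; +-identityʳ; 1+n≢n; n<1+n; m+n∸n≡m; m≤n+m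
        ; <-irrefl; <-asym; <ᵇ⇒<; <⇒<ᵇ)
open import Data.Nat.ListAction using (sum)
open import Data.Nat.DivMod using ([m+kn]%n≡m%n)
import Data.Nat.Tactic.RingSolver as ℕSolver
open import Data.Bool using (true; false; if_then_else_; _∧_; T)
open import Data.Empty using (⊥-elim)
open import Data.Sum using (_⊎_; inj₁; inj₂)
open import Data.Product as Product using (_×_; _,_; proj₂; ∃; ∃₂)
open import Data.Fin as Fin using (Fin; zero; suc; toℕ; fromℕ; inject₁)
import Data.Fin.Properties as FinP
open import Data.Integer using (ℤ; +_; 0ℤ; 1ℤ) renaming (_+_ to _+ℤ_; _*_ to _*ℤ_; _-_ to _-ℤ_)
import Data.Integer.Properties as ℤP
open import Data.Integer.Tactic.RingSolver using (solve-∀)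
open import Data.List
  using (List; []; _∷_; _++_; map; filter; length; concatMap; tabulate; allFin; cartesianProductWith)
import Data.List.Properties as ListP
open import Data.List.Membership.Propositional using (_∈_)
import Data.List.Membership.Propositional.Properties as MembershipP
open import Data.List.Membership.Propositional.Properties.WithK using (unique∧set⇒bag)
open import Data.List.Relation.Unary.All as All using (All; []; _∷_)
import Data.List.Relation.Unary.All.Properties as AllP
open import Data.List.Relation.Unary.Any as Any using (here; there)
open import Data.List.Relation.Unary.Unique.Propositional using (Unique; []; _∷_)
import Data.List.Relation.Unary.Unique.Propositional.Properties as UniqueP
import Data.List.Relation.Unary.Unique.DecPropositional as UniqueDec
open import Data.List.Relation.Binary.Pointwise as Pointwise using (Pointwise; []; _∷_)
open import Data.List.Relation.Binary.Permutation.Propositional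
  using (_↭_; ↭-refl; ↭-sym; ↭-trans; ↭-prep; ↭-swap; ↭⇒↭ₛ)
import Data.List.Relation.Binary.Permutation.Propositional.Properties as PermutationP
import Data.List.Relation.Binary.Permutation.Setoid.Properties as PermutationSetoidP
open import Data.List.Relation.Binary.BagAndSetEquality using (∼bag⇒↭)
open import Data.Vec as Vec using (Vec; []; _∷_; toList)
import Data.Vec.Properties as VecP
open import Data.Vec.Membership.Propositional.Properties using (∈-toList⁺; ∈-lookup)
open import Function using (_∘_; id; mk⇔)
open import Relation.Nullary using (¬_; Dec; yes; no; does)
open import Relation.Nullary.Decidable using (_×-dec_; dec-true; dec-false)
open import Relation.Unary using (Decidable)
open import Relation.Binary.PropositionalEquality
  using (_≡_; _≢_; _≗_; refl; sym; trans; cong; cong₂; subst; setoid; module ≡-Reasoning)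

private
  variable
    k m n D : ℕ

private
  combination-+ : ∀ a b x y z w →
    a *ℤ (x +ℤ y) +ℤ b *ℤ (z +ℤ w) ≡ (a *ℤ x +ℤ b *ℤ z) +ℤ (a *ℤ y +ℤ b *ℤ w)
  combination-+ = solve-∀

  a*0+b*0≡0 : ∀ a b → a *ℤ 0ℤ +ℤ b *ℤ 0ℤ ≡ 0ℤ
  a*0+b*0≡0 = solve-∀

  a*1+b*0≡a : ∀ a b → a *ℤ 1ℤ +ℤ b *ℤ 0ℤ ≡ a
  a*1+b*0≡a = solve-∀

  a*0+b*1≡b : ∀ a b → a *ℤ 0ℤ +ℤ b *ℤ 1ℤ ≡ b
  a*0+b*1≡b = solve-∀

  pos-∸ : ∀ {m n} → n ≤ m → + (m ∸ n) ≡ (+ m) -ℤ (+ n)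
  pos-∸ {m} {n} n≤m = trans (sym (ℤP.⊖-≥ n≤m)) (sym (ℤP.m-n≡m⊖n m n))

  x+y+z≡z+y+x : ∀ x y z → x + y + z ≡ z + y + x
  x+y+z≡z+y+x = ℕSolver.solve-∀

_+ₚ_ : Poly → Poly → Poly
(p +ₚ q) k = p k +ℤ q k

0ₚ : Poly
0ₚ _ = 0ℤ

monomial : ℕ → Poly
monomial d k = if does (d ≟ k) then 1ℤ else 0ℤ

monomial-diag : ∀ d → monomial d d ≡ 1ℤ
monomial-diag d rewrite dec-true (d ≟ d) refl = refl

monomial-off : ∀ {d k} → d ≢ k → monomial d k ≡ 0ℤ
monomial-off {d} {k} d≢k rewrite dec-false (d ≟ k) d≢k = refl

record Linear (L : Poly → Poly) : Set where
  field
    ≗-cong : ∀ {p q} → p ≗ q → L p ≗ L q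
    +-homo : ∀ p q → L (p +ₚ q) ≗ L p +ₚ L q
    0-homo : L 0ₚ ≗ 0ₚ

Δ-coefficient : ∀ m p k {x y} → p (suc k) ≡ x → p k ≡ y →
  Δ m p k ≡ (+ suc k) *ℤ x +ℤ ((+ suc m) -ℤ (+ k)) *ℤ y
Δ-coefficient m p k = cong₂ (λ x y → (+ suc k) *ℤ x +ℤ ((+ suc m) -ℤ (+ k)) *ℤ y)

Δ-linear : Linear (Δ m)
Δ-linear {m} = record
  { ≗-cong = λ {p} p≗q j → Δ-coefficient m p j (p≗q (suc j)) (p≗q j)
  ; +-homo = λ p q j → combination-+ (+ suc j) ((+ suc m) -ℤ (+ j)) (p (suc j)) (q (suc j)) (p j) (q j)
  ; 0-homo = λ j → a*0+b*0≡0 (+ suc j) ((+ suc m) -ℤ (+ j))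
  }

Γ-linear : Linear (Γ m)
Γ-linear {m} = record { ≗-cong = ≗-cong ; +-homo = +-homo ; 0-homo = 0-homo }
  where
  ≗-cong : ∀ {p q} → p ≗ q → Γ m p ≗ Γ m q
  ≗-cong p≗q zero    = cong ((+ 1) *ℤ_) (p≗q zero)
  ≗-cong p≗q (suc j) =
    cong₂ (λ x y → (+ suc (suc j)) *ℤ x +ℤ ((+ m) -ℤ (+ j)) *ℤ y) (p≗q (suc j)) (p≗q j)
  +-homo : ∀ p q → Γ m (p +ₚ q) ≗ Γ m p +ₚ Γ m q
  +-homo p q zero    = ℤP.*-distribˡ-+ (+ 1) (p zero) (q zero)
  +-homo p q (suc j) =
    combination-+ (+ suc (suc j)) ((+ m) -ℤ (+ j)) (p (suc j)) (q (suc j)) (p j) (q j)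
  0-homo : Γ m 0ₚ ≗ 0ₚ
  0-homo zero    = refl
  0-homo (suc j) = a*0+b*0≡0 (+ suc (suc j)) ((+ m) -ℤ (+ j))

-- Definitionally, monomial (suc d) (suc j) is monomial d j and monomial (suc d) 0 is 0ℤ.
Δ-monomial-suc≗Γ-monomial : ∀ d → Δ m (monomial (suc d)) ≗ Γ m (monomial d)
Δ-monomial-suc≗Γ-monomial {m} d zero =
  trans (cong ((+ 1) *ℤ monomial d zero +ℤ_) (ℤP.*-zeroʳ ((+ suc m) -ℤ (+ 0)))) (ℤP.+-identityʳ _)
Δ-monomial-suc≗Γ-monomial {m} d (suc j) =
  cong (λ c → (+ suc (suc j)) *ℤ monomial d (suc j) +ℤ c *ℤ monomial d j)
       (trans (ℤP.[1+m]⊖[1+n]≡m⊖n m j) (sym (ℤP.m-n≡m⊖n m j)))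

Δ-monomial-pred : ∀ m k → Δ m (monomial (suc k)) k ≡ + suc k
Δ-monomial-pred m k = trans
  (Δ-coefficient m (monomial (suc k)) k (monomial-diag (suc k)) (monomial-off (1+n≢n {k})))
  (a*1+b*0≡a (+ suc k) ((+ suc m) -ℤ (+ k)))

Δ-monomial-diag : ∀ m k → Δ m (monomial k) k ≡ (+ suc m) -ℤ (+ k)
Δ-monomial-diag m k = trans
  (Δ-coefficient m (monomial k) k (monomial-off (1+n≢n {k} ∘ sym)) (monomial-diag k))
  (a*0+b*1≡b (+ suc k) ((+ suc m) -ℤ (+ k)))

Δ-monomial-off : ∀ {d} m k → d ≢ k → d ≢ suc k → Δ m (monomial d) k ≡ 0ℤ
Δ-monomial-off {d} m k d≢k d≢1+k = trans
  (Δ-coefficient m (monomial d) k (monomial-off d≢1+k) (monomial-off d≢k))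
  (a*0+b*0≡0 (+ suc k) ((+ suc m) -ℤ (+ k)))

-- Generating polynomials of lists of statistics

occurrences : ℕ → List ℕ → ℕ
occurrences k = length ∘ filter (_≟ k)

generating : List ℕ → Poly
generating ds k = + occurrences k ds

occurrences-here : ∀ k ts → occurrences k (k ∷ ts) ≡ suc (occurrences k ts)
occurrences-here k ts = cong length (ListP.filter-accept (_≟ k) refl)

occurrences-there : ∀ {t} k ts → t ≢ k → occurrences k (t ∷ ts) ≡ occurrences k ts
occurrences-there k ts t≢k = cong length (ListP.filter-reject (_≟ k) t≢k)

generating-∷ : ∀ d ds → generating (d ∷ ds) ≗ monomial d +ₚ generating ds
generating-∷ d ds k with d ≟ k
... | yes refl =
  trans (cong +_ (occurrences-here d ds)) (cong (_+ℤ generating ds d) (sym (monomial-diag d)))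
... | no d≢k   =
  trans (cong +_ (occurrences-there k ds d≢k)) (cong (_+ℤ generating ds k) (sym (monomial-off d≢k)))

generating-++ : ∀ xs ys → generating (xs ++ ys) ≗ generating xs +ₚ generating ys
generating-++ xs ys k = begin
  + length (filter (_≟ k) (xs ++ ys))
    ≡⟨ cong (+_ ∘ length) (ListP.filter-++ (_≟ k) xs ys) ⟩
  + length (filter (_≟ k) xs ++ filter (_≟ k) ys)
    ≡⟨ cong +_ (ListP.length-++ (filter (_≟ k) xs)) ⟩
  + (occurrences k xs + occurrences k ys)
    ≡⟨ ℤP.pos-+ (occurrences k xs) _ ⟩
  generating xs k +ℤ generating ys k
    ∎
  where open ≡-Reasoning

generating-↭ : ∀ {xs ys} → xs ↭ ys → generating xs ≗ generating ys
generating-↭ xs↭ys k = cong +_ (PermutationP.↭-length (PermutationP.filter-↭ (_≟ k) xs↭ys))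

generating-concatMap : ∀ {A : Set} {L} → Linear L → (f : A → List ℕ) (g : A → ℕ) →
  (∀ x → generating (f x) ≗ L (monomial (g x))) →
  ∀ xs → generating (concatMap f xs) ≗ L (generating (map g xs))
generating-concatMap lin f g fx≗ [] k = sym (Linear.0-homo lin k)
generating-concatMap {L = L} lin f g fx≗ (x ∷ xs) k = begin
  generating (f x ++ concatMap f xs) k
    ≡⟨ generating-++ (f x) (concatMap f xs) k ⟩
  generating (f x) k +ℤ generating (concatMap f xs) k
    ≡⟨ cong₂ _+ℤ_ (fx≗ x k) (generating-concatMap lin f g fx≗ xs k) ⟩
  L (monomial (g x)) k +ℤ L (generating (map g xs)) k
    ≡⟨ Linear.+-homo lin (monomial (g x)) (generating (map g xs)) k ⟨
  L (monomial (g x) +ₚ generating (map g xs)) k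
    ≡⟨ Linear.≗-cong lin (generating-∷ (g x) (map g xs)) k ⟨
  L (generating (g x ∷ map g xs)) k
    ∎
  where open ≡-Reasoning

Complements : ℕ → List ℕ → List ℕ → Set
Complements D = Pointwise (λ t e → t + e ≡ D)

private
  deficit-cases : ∀ t {e D} → t + e ≡ D → e ≤ 1 → (t ≡ D × e ≡ 0) ⊎ (suc t ≡ D × e ≡ 1)
  deficit-cases t refl z≤n       = inj₁ (sym (+-identityʳ t) , refl)
  deficit-cases t refl (s≤s z≤n) = inj₂ (+-comm 1 t , refl)

occurrences-pred : ∀ {ts es} → Complements (suc k) ts es → All (_≤ 1) es → occurrences k ts ≡ sum es
occurrences-pred [] [] = refl
occurrences-pred {k} {t ∷ ts} (c ∷ cs) (b ∷ bs) with deficit-cases t c b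
... | inj₁ (refl , refl) = trans (occurrences-there k ts 1+n≢n) (occurrences-pred cs bs)
... | inj₂ (refl , refl) = trans (occurrences-here k ts) (cong suc (occurrences-pred cs bs))

occurrences-total : ∀ {ts es} → Complements D ts es → All (_≤ 1) es →
  occurrences D ts + sum es ≡ length es
occurrences-total [] [] = refl
occurrences-total {ts = t ∷ ts} {e ∷ es} (c ∷ cs) (b ∷ bs) with deficit-cases t c b
... | inj₁ (refl , refl) =
  trans (cong (_+ sum es) (occurrences-here t ts)) (cong suc (occurrences-total cs bs))
... | inj₂ (refl , refl) = begin
  occurrences (suc t) (t ∷ ts) + suc (sum es)
    ≡⟨ cong (_+ suc (sum es)) (occurrences-there (suc t) ts (1+n≢n ∘ sym)) ⟩
  occurrences (suc t) ts + suc (sum es)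
    ≡⟨ +-suc _ (sum es) ⟩
  suc (occurrences (suc t) ts + sum es)
    ≡⟨ cong suc (occurrences-total cs bs) ⟩
  suc (length es)
    ∎
  where open ≡-Reasoning

occurrences-other : ∀ {ts es} → Complements D ts es → All (_≤ 1) es → k ≢ D → suc k ≢ D →
  occurrences k ts ≡ 0
occurrences-other [] [] _ _ = refl
occurrences-other {k = k} {ts = t ∷ ts} (c ∷ cs) (b ∷ bs) k≢D 1+k≢D with deficit-cases t c b
... | inj₁ (refl , refl) =
  trans (occurrences-there k ts (k≢D ∘ sym)) (occurrences-other cs bs k≢D 1+k≢D)
... | inj₂ (refl , refl) =
  trans (occurrences-there k ts (1+k≢D ∘ sym ∘ cong suc)) (occurrences-other cs bs k≢D 1+k≢D)

-- The entries with deficit 1 are the D entries equal to D ∸ 1, the others are the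
-- suc m ∸ D entries equal to D: together they form Δ_m x^D.
generating-Δ : ∀ {ts es} → Complements D ts es → All (_≤ 1) es → sum es ≡ D → length es ≡ suc m →
  generating ts ≗ Δ m (monomial D)
generating-Δ {D} {m} {ts} {es} c bits sum≡D len≡ k with D ≟ suc k | D ≟ k
... | yes refl | _ = trans (cong +_ (trans (occurrences-pred c bits) sum≡D)) (sym (Δ-monomial-pred m k))
... | no _ | yes refl = begin
  + occurrences D ts   ≡⟨ cong +_ occurrences≡ ⟩
  + (suc m ∸ D)        ≡⟨ pos-∸ D≤1+m ⟩
  (+ suc m) -ℤ (+ D)   ≡⟨ Δ-monomial-diag m D ⟨
  Δ m (monomial D) D   ∎
  where
  open ≡-Reasoning
  total : occurrences D ts + D ≡ suc m
  total = trans (cong (λ s → occurrences D ts + s) (sym sum≡D)) (trans (occurrences-total c bits) len≡)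
  occurrences≡ : occurrences D ts ≡ suc m ∸ D
  occurrences≡ = trans (sym (m+n∸n≡m (occurrences D ts) D)) (cong (_∸ D) total)
  D≤1+m : D ≤ suc m
  D≤1+m = subst (D ≤_) total (m≤n+m D (occurrences D ts))
... | no D≢1+k | no D≢k =
  trans (cong +_ (occurrences-other c bits (D≢k ∘ sym) (D≢1+k ∘ sym)))
        (sym (Δ-monomial-off m k D≢k D≢1+k))

-- Even descents of words over ℕ and insertion of a largest letter

evenDescent : ℕ → ℕ → ℕ
evenDescent a b = if (b <ᵇ a) ∧ ((a % 2) ≡ᵇ 0) then 1 else 0

evenBit : ℕ → ℕ
evenBit a = if (a % 2) ≡ᵇ 0 then 1 else 0

evenDescents : List ℕ → ℕ
evenDescents []          = 0
evenDescents (a ∷ [])    = 0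
evenDescents (a ∷ b ∷ w) = evenDescent a b + evenDescents (b ∷ w)

evenDescent-< : ∀ {a b} → a < b → evenDescent a b ≡ 0
evenDescent-< {a} {b} a<b with b <ᵇ a in b<ᵇa
... | false = refl
... | true  = ⊥-elim (<-asym a<b (<ᵇ⇒< b a (subst T (sym b<ᵇa) _)))

evenDescent-> : ∀ {a b} → b < a → evenDescent a b ≡ evenBit a
evenDescent-> {a} {b} b<a with b <ᵇ a | <⇒<ᵇ b<a
... | true | _ = refl

evenDescent≤1 : ∀ a b → evenDescent a b ≤ 1
evenDescent≤1 a b with (b <ᵇ a) ∧ ((a % 2) ≡ᵇ 0)
... | true  = s≤s z≤n
... | false = z≤n

evenBit≤1 : ∀ a → evenBit a ≤ 1
evenBit≤1 a with (a % 2) ≡ᵇ 0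
... | true  = s≤s z≤n
... | false = z≤n

insertions : ℕ → List ℕ → List (List ℕ)
insertions M []      = (M ∷ []) ∷ []
insertions M (a ∷ w) = (M ∷ a ∷ w) ∷ map (a ∷_) (insertions M w)

-- For a word w of letters below M, the i-th word of insertions M w has evenDescents w + evenBit M
-- even descents minus the i-th deficit: M's own even descent when M is placed last, otherwise the
-- even descent between the two letters M separates (nothing when M is placed first).
module _ (M : ℕ) where

  deficitsAfter : ℕ → List ℕ → List ℕ
  deficitsAfter a []      = evenBit M ∷ []
  deficitsAfter a (b ∷ w) = evenDescent a b ∷ deficitsAfter b w

  deficits : List ℕ → List ℕ
  deficits []      = evenBit M ∷ []
  deficits (a ∷ w) = 0 ∷ deficitsAfter a w

Pointwise-mapˡ : ∀ {A B C : Set} {R : C → B → Set} (f : A → C) {xs ys} →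
  Pointwise (λ x y → R (f x) y) xs ys → Pointwise R (map f xs) ys
Pointwise-mapˡ f []       = []
Pointwise-mapˡ f (r ∷ rs) = r ∷ Pointwise-mapˡ f rs

module _ {M : ℕ} where

  length-deficitsAfter : ∀ a w → length (deficitsAfter M a w) ≡ suc (length w)
  length-deficitsAfter a []      = refl
  length-deficitsAfter a (b ∷ w) = cong suc (length-deficitsAfter b w)

  length-deficits : ∀ w → length (deficits M w) ≡ suc (length w)
  length-deficits []      = refl
  length-deficits (a ∷ w) = cong suc (length-deficitsAfter a w)

  deficitsAfter≤1 : ∀ a w → All (_≤ 1) (deficitsAfter M a w)
  deficitsAfter≤1 a []      = evenBit≤1 M ∷ []
  deficitsAfter≤1 a (b ∷ w) = evenDescent≤1 a b ∷ deficitsAfter≤1 b w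

  deficits≤1 : ∀ w → All (_≤ 1) (deficits M w)
  deficits≤1 []      = evenBit≤1 M ∷ []
  deficits≤1 (a ∷ w) = z≤n ∷ deficitsAfter≤1 a w

  sum-deficitsAfter : ∀ a w → sum (deficitsAfter M a w) ≡ evenDescents (a ∷ w) + evenBit M
  sum-deficitsAfter a []      = +-identityʳ (evenBit M)
  sum-deficitsAfter a (b ∷ w) = trans (cong (_+_ (evenDescent a b)) (sum-deficitsAfter b w))
                                      (sym (+-assoc (evenDescent a b) (evenDescents (b ∷ w)) (evenBit M)))

  sum-deficits : ∀ w → sum (deficits M w) ≡ evenDescents w + evenBit M
  sum-deficits []      = +-identityʳ (evenBit M)
  sum-deficits (a ∷ w) = sum-deficitsAfter a w

  insertionsAfter-complement : ∀ {a w} → All (_< M) (a ∷ w) →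
    Pointwise (λ y e → evenDescents (a ∷ y) + e ≡ evenDescents (a ∷ w) + evenBit M)
              (insertions M w) (deficitsAfter M a w)
  insertionsAfter-complement {a} {[]} (a<M ∷ []) =
    cong (λ x → x + 0 + evenBit M) (evenDescent-< a<M) ∷ []
  insertionsAfter-complement {a} {b ∷ w} (a<M ∷ b<M∷w@(b<M ∷ _)) =
    head ∷ Pointwise-mapˡ (b ∷_) (Pointwise.map (λ {y} → step {y}) (insertionsAfter-complement b<M∷w))
    where
    E : ℕ
    E = evenDescents (b ∷ w)
    head : evenDescent a M + (evenDescent M b + E) + evenDescent a b ≡ evenDescent a b + E + evenBit M
    head rewrite evenDescent-< a<M | evenDescent-> b<M =
      x+y+z≡z+y+x (evenBit M) E (evenDescent a b)
    step : ∀ {y e} → evenDescents (b ∷ y) + e ≡ E + evenBit M →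
           evenDescent a b + evenDescents (b ∷ y) + e ≡ evenDescent a b + E + evenBit M
    step {y} {e} eq = trans (+-assoc (evenDescent a b) (evenDescents (b ∷ y)) e)
                     (trans (cong (_+_ (evenDescent a b)) eq) (sym (+-assoc (evenDescent a b) E (evenBit M))))

  insertions-complement : ∀ {w} → All (_< M) w →
    Pointwise (λ y e → evenDescents y + e ≡ evenDescents w + evenBit M) (insertions M w) (deficits M w)
  insertions-complement {[]}    []            = refl ∷ []
  insertions-complement {a ∷ w} a∷w<M@(a<M ∷ _) =
    head ∷ Pointwise-mapˡ (a ∷_) (insertionsAfter-complement a∷w<M)
    where
    head : evenDescent M a + evenDescents (a ∷ w) + 0 ≡ evenDescents (a ∷ w) + evenBit M
    head rewrite evenDescent-> a<M = trans (+-identityʳ _) (+-comm (evenBit M) _)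

  generating-insertions : ∀ {w} → All (_< M) w →
    generating (map evenDescents (insertions M w)) ≗ Δ (length w) (monomial (evenDescents w + evenBit M))
  generating-insertions {w} w<M = generating-Δ (Pointwise-mapˡ evenDescents (insertions-complement w<M))
    (deficits≤1 w) (sum-deficits w) (length-deficits w)

-- Permutations as vectors over Fin

vals : Vec (Fin n) m → List ℕ
vals v = map val (toList v)

desEList-evenDescents : (w : List (Fin n)) → desEList w ≡ evenDescents (map val w)
desEList-evenDescents []          = refl
desEList-evenDescents (a ∷ [])    = refl
desEList-evenDescents (a ∷ b ∷ w) =
  cong (_+_ (evenDescent (val a) (val b))) (desEList-evenDescents (b ∷ w))

vals<suc : (v : Vec (Fin n) m) → All (_< suc n) (vals v)
vals<suc []      = []
vals<suc (a ∷ v) = s≤s (FinP.toℕ<n a) ∷ vals<suc v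

length-vals : (v : Vec (Fin n) m) → length (vals v) ≡ m
length-vals v = trans (ListP.length-map val (toList v)) (VecP.length-toList v)

vals-map-inject₁ : (v : Vec (Fin n) m) → vals (Vec.map inject₁ v) ≡ vals v
vals-map-inject₁ []      = refl
vals-map-inject₁ (a ∷ v) = cong₂ _∷_ (cong suc (FinP.toℕ-inject₁ a)) (vals-map-inject₁ v)

insertMax : Vec (Fin n) m → Fin (suc m) → Vec (Fin (suc n)) (suc m)
insertMax {n} τ p = Vec.insertAt (Vec.map inject₁ τ) p (fromℕ n)

tabulate-vals-insertMax : (τ : Vec (Fin n) m) →
  tabulate (vals ∘ insertMax τ) ≡ insertions (suc n) (vals τ)
tabulate-vals-insertMax {n} []      = cong (λ x → (suc x ∷ []) ∷ []) (FinP.toℕ-fromℕ n)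
tabulate-vals-insertMax {n} (a ∷ τ) =
  cong₂ _∷_ (cong₂ _∷_ (cong suc (FinP.toℕ-fromℕ n)) (vals-map-inject₁ (a ∷ τ))) (begin
  tabulate (λ p → val (inject₁ a) ∷ vals (insertMax τ p))
    ≡⟨ ListP.tabulate-cong (λ p → cong (λ x → suc x ∷ vals (insertMax τ p)) (FinP.toℕ-inject₁ a)) ⟩
  tabulate ((val a ∷_) ∘ vals ∘ insertMax τ)
    ≡⟨ ListP.map-tabulate (vals ∘ insertMax τ) (val a ∷_) ⟨
  map (val a ∷_) (tabulate (vals ∘ insertMax τ))
    ≡⟨ cong (map (val a ∷_)) (tabulate-vals-insertMax τ) ⟩
  map (val a ∷_) (insertions (suc n) (vals τ))
    ∎)
  where open ≡-Reasoning

generating-insertMax : (τ : Vec (Fin m) m) →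
  generating (map desE (tabulate (insertMax τ))) ≗ Δ m (monomial (desE τ + evenBit (suc m)))
generating-insertMax {m} τ k = begin
  generating (map desE (tabulate (insertMax τ))) k
    ≡⟨ cong (λ ds → generating ds k) statistics ⟩
  generating (map evenDescents (insertions (suc m) (vals τ))) k
    ≡⟨ generating-insertions (vals<suc τ) k ⟩
  Δ (length (vals τ)) (monomial (evenDescents (vals τ) + evenBit (suc m))) k
    ≡⟨ cong₂ (λ l d → Δ l (monomial (d + evenBit (suc m))) k)
             (length-vals τ) (sym (desEList-evenDescents (toList τ))) ⟩
  Δ m (monomial (desE τ + evenBit (suc m))) k
    ∎
  where
  open ≡-Reasoning
  statistics : map desE (tabulate (insertMax τ)) ≡ map evenDescents (insertions (suc m) (vals τ))
  statistics = begin
    map desE (tabulate (insertMax τ))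
      ≡⟨ ListP.map-tabulate (insertMax τ) desE ⟩
    tabulate (desE ∘ insertMax τ)
      ≡⟨ ListP.tabulate-cong (desEList-evenDescents ∘ toList ∘ insertMax τ) ⟩
    tabulate (evenDescents ∘ vals ∘ insertMax τ)
      ≡⟨ ListP.map-tabulate (vals ∘ insertMax τ) evenDescents ⟨
    map evenDescents (tabulate (vals ∘ insertMax τ))
      ≡⟨ cong (map evenDescents) (tabulate-vals-insertMax τ) ⟩
    map evenDescents (insertions (suc m) (vals τ))
      ∎

cartesianProductWith-concatMap : ∀ {A B C : Set} (f : A → B → C) xs ys →
  cartesianProductWith f xs ys ≡ concatMap (λ x → map (f x) ys) xs
cartesianProductWith-concatMap f []       ys = refl
cartesianProductWith-concatMap f (x ∷ xs) ys =
  cong (map (f x) ys ++_) (cartesianProductWith-concatMap f xs ys)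

allVecs-suc : ∀ n m →
  allVecs n (suc m) ≡ cartesianProductWith (λ v i → i ∷ v) (allVecs n m) (allFin n)
allVecs-suc n m = sym (cartesianProductWith-concatMap (λ v i → i ∷ v) (allVecs n m) (allFin n))

unique-allVecs : ∀ n m → Unique (allVecs n m)
unique-allVecs n zero    = [] ∷ []
unique-allVecs n (suc m) rewrite allVecs-suc n m =
  UniqueP.cartesianProductWith⁺ (λ v i → i ∷ v) (Product.swap ∘ VecP.∷-injective)
    (unique-allVecs n m) (UniqueP.allFin⁺ n)

∈-allVecs : (v : Vec (Fin n) m) → v ∈ allVecs n m
∈-allVecs []                      = here refl
∈-allVecs {n} {suc m} (a ∷ v) rewrite allVecs-suc n m =
  MembershipP.∈-cartesianProductWith⁺ (λ v i → i ∷ v) (∈-allVecs v) (MembershipP.∈-allFin a)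

unique? : (v : Vec (Fin n) m) → Dec (Unique (toList v))
unique? v = UniqueDec.unique? FinP._≟_ (toList v)

Perms : ∀ n → List (Vec (Fin n) n)
Perms n = filter unique? (allVecs n n)

unique-Perms : ∀ n → Unique (Perms n)
unique-Perms n = UniqueP.filter⁺ unique? (unique-allVecs n n)

∈-Perms⁺ : {v : Vec (Fin n) n} → Unique (toList v) → v ∈ Perms n
∈-Perms⁺ {v = v} = MembershipP.∈-filter⁺ unique? (∈-allVecs v)

∈-Perms⁻ : {v : Vec (Fin n) n} → v ∈ Perms n → Unique (toList v)
∈-Perms⁻ {n} = proj₂ ∘ MembershipP.∈-filter⁻ unique? {xs = allVecs n n}

length-filter-×-dec : ∀ {A : Set} {P : A → Set} (P? : Decidable P) (f : A → ℕ) k xs →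
  length (filter (λ x → P? x ×-dec (f x ≟ k)) xs) ≡ occurrences k (map f (filter P? xs))
length-filter-×-dec P? f k []       = refl
length-filter-×-dec P? f k (x ∷ xs) with does (P? x)
... | false = length-filter-×-dec P? f k xs
... | true with f x ≡ᵇ k
...   | true  = cong suc (length-filter-×-dec P? f k xs)
...   | false = length-filter-×-dec P? f k xs

R-generating : ∀ n → R n ≗ generating (map desE (Perms n))
R-generating n k = cong +_ (length-filter-×-dec unique? desE k (allVecs n n))

map-inject₁-injective : ∀ {τ σ : Vec (Fin n) m} → Vec.map inject₁ τ ≡ Vec.map inject₁ σ → τ ≡ σ
map-inject₁-injective {τ = []}    {[]}    _  = refl
map-inject₁-injective {τ = a ∷ τ} {b ∷ σ} eq =
  cong₂ _∷_ (FinP.inject₁-injective (VecP.∷-injectiveˡ eq)) (map-inject₁-injective (VecP.∷-injectiveʳ eq))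

insertMax-injective : ∀ {τ σ : Vec (Fin n) m} {p q} → insertMax τ p ≡ insertMax σ q → τ ≡ σ × p ≡ q
insertMax-injective {p = zero}  {zero}  eq = map-inject₁-injective (VecP.∷-injectiveʳ eq) , refl
insertMax-injective {τ = _ ∷ _} {_ ∷ _} {zero}  {suc q} eq =
  ⊥-elim (FinP.fromℕ≢inject₁ (VecP.∷-injectiveˡ eq))
insertMax-injective {τ = _ ∷ _} {_ ∷ _} {suc p} {zero}  eq =
  ⊥-elim (FinP.fromℕ≢inject₁ (sym (VecP.∷-injectiveˡ eq)))
insertMax-injective {τ = a ∷ τ} {b ∷ σ} {suc p} {suc q} eq with insertMax-injective (VecP.∷-injectiveʳ eq)
... | refl , refl = cong (_∷ τ) (FinP.inject₁-injective (VecP.∷-injectiveˡ eq)) , refl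

toList-insertAt-↭ : ∀ {A : Set} (xs : Vec A m) i x → toList (Vec.insertAt xs i x) ↭ x ∷ toList xs
toList-insertAt-↭ xs       zero    x = ↭-refl
toList-insertAt-↭ (y ∷ xs) (suc i) x =
  ↭-trans (↭-prep y (toList-insertAt-↭ xs i x)) (↭-swap y x ↭-refl)

unique-resp-↭ : ∀ {A : Set} {xs ys : List A} → xs ↭ ys → Unique xs → Unique ys
unique-resp-↭ {A} xs↭ys = PermutationSetoidP.Unique-resp-↭ (setoid A) (↭⇒↭ₛ xs↭ys)

toList-insertMax-↭ : (τ : Vec (Fin n) m) (p : Fin (suc m)) →
  toList (insertMax τ p) ↭ fromℕ n ∷ map inject₁ (toList τ)
toList-insertMax-↭ {n} τ p =
  subst (λ l → toList (insertMax τ p) ↭ fromℕ n ∷ l) (VecP.toList-map inject₁ τ)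
        (toList-insertAt-↭ (Vec.map inject₁ τ) p (fromℕ n))

unique-insertMax⁺ : (τ : Vec (Fin n) m) (p : Fin (suc m)) →
  Unique (toList τ) → Unique (toList (insertMax τ p))
unique-insertMax⁺ τ p u = unique-resp-↭ (↭-sym (toList-insertMax-↭ τ p))
  (AllP.map⁺ (All.universal (λ _ → FinP.fromℕ≢inject₁) (toList τ)) ∷ UniqueP.map⁺ FinP.inject₁-injective u)

unique-insertMax⁻ : (τ : Vec (Fin n) m) (p : Fin (suc m)) →
  Unique (toList (insertMax τ p)) → Unique (toList τ)
unique-insertMax⁻ τ p u with unique-resp-↭ (toList-insertMax-↭ τ p) u
... | _ ∷ u′ = UniqueP.map⁻ u′

≢fromℕ⇒inject₁ : {a : Fin (suc n)} → a ≢ fromℕ n → ∃ λ b → inject₁ b ≡ a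
≢fromℕ⇒inject₁ {n} {a} a≢max = Fin.lower₁ a n≢a , FinP.inject₁-lower₁ a n≢a
  where
  n≢a : n ≢ toℕ a
  n≢a n≡a = a≢max (FinP.toℕ-injective (trans (sym n≡a) (sym (FinP.toℕ-fromℕ n))))

map-inject₁-surjective : (x : Vec (Fin (suc n)) m) → All (_≢ fromℕ n) (toList x) →
  ∃ λ y → Vec.map inject₁ y ≡ x
map-inject₁-surjective []      []             = [] , refl
map-inject₁-surjective (a ∷ x) (a≢max ∷ x≢max) with ≢fromℕ⇒inject₁ a≢max | map-inject₁-surjective x x≢max
... | b , refl | y , refl = b ∷ y , refl

lookup-injective : ∀ {A : Set} (y : Vec A m) → Unique (toList y) →
  ∀ {i j} → Vec.lookup y i ≡ Vec.lookup y j → i ≡ j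
lookup-injective (a ∷ y) u        {zero}  {zero}  eq = refl
lookup-injective (a ∷ y) (a∉y ∷ _) {zero}  {suc j} eq = ⊥-elim (All.lookup a∉y (∈-toList⁺ (∈-lookup j y)) eq)
lookup-injective (a ∷ y) (a∉y ∷ _) {suc i} {zero}  eq = ⊥-elim (All.lookup a∉y (∈-toList⁺ (∈-lookup i y)) (sym eq))
lookup-injective (a ∷ y) (_ ∷ u)   {suc i} {suc j} eq = cong suc (lookup-injective y u eq)

<⇒¬unique : m < n → (y : Vec (Fin m) n) → ¬ Unique (toList y)
<⇒¬unique m<n y u with FinP.pigeonhole m<n (Vec.lookup y)
... | i , j , i<j , yi≡yj = <-irrefl (cong toℕ (lookup-injective y u yi≡yj)) i<j

unique⇒fromℕ∈ : (x : Vec (Fin (suc m)) (suc m)) → Unique (toList x) → fromℕ m ∈ toList x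
unique⇒fromℕ∈ {m} x u with Any.any? (fromℕ m FinP.≟_) (toList x)
... | yes max∈x = max∈x
... | no  max∉x with map-inject₁-surjective x (All.map (_∘ sym) (AllP.¬Any⇒All¬ (toList x) max∉x))
...   | y , refl =
  ⊥-elim (<⇒¬unique (n<1+n m) y (UniqueP.map⁻ (subst Unique (VecP.toList-map inject₁ y) u)))

insertMax-surjective : (x : Vec (Fin (suc n)) (suc m)) → Unique (toList x) → fromℕ n ∈ toList x →
  ∃₂ λ τ p → insertMax τ p ≡ x
insertMax-surjective (_ ∷ x) (max∉x ∷ _) (here refl) with map-inject₁-surjective x (All.map (_∘ sym) max∉x)
... | y , refl = y , zero , refl
insertMax-surjective {m = zero}  (a ∷ []) _              (there ())
insertMax-surjective {m = suc m} (a ∷ x)  (a∉x ∷ ux) (there max∈x)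
  with ≢fromℕ⇒inject₁ (All.lookup a∉x max∈x) | insertMax-surjective x ux max∈x
... | b , refl | τ , p , refl = b ∷ τ , suc p , refl

Perms-suc-↭ : Perms (suc m) ↭ concatMap (tabulate ∘ insertMax) (Perms m)
Perms-suc-↭ {m} =
  subst (Perms (suc m) ↭_) image≡ (∼bag⇒↭ (unique∧set⇒bag (unique-Perms (suc m)) unique-image (mk⇔ to from)))
  where
  image = cartesianProductWith insertMax (Perms m) (allFin (suc m))
  image≡ : image ≡ concatMap (tabulate ∘ insertMax) (Perms m)
  image≡ = trans (cartesianProductWith-concatMap insertMax (Perms m) (allFin (suc m)))
                 (ListP.concatMap-cong (λ τ → ListP.map-tabulate id (insertMax τ)) (Perms m))
  unique-image : Unique image
  unique-image =
    UniqueP.cartesianProductWith⁺ insertMax insertMax-injective (unique-Perms m) (UniqueP.allFin⁺ (suc m))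
  to : ∀ {x} → x ∈ Perms (suc m) → x ∈ image
  to {x} x∈ with ∈-Perms⁻ x∈
  ... | ux with insertMax-surjective x ux (unique⇒fromℕ∈ x ux)
  ...   | τ , p , refl = MembershipP.∈-cartesianProductWith⁺ insertMax
                           (∈-Perms⁺ (unique-insertMax⁻ τ p ux)) (MembershipP.∈-allFin p)
  from : ∀ {x} → x ∈ image → x ∈ Perms (suc m)
  from x∈ with MembershipP.∈-cartesianProductWith⁻ insertMax (Perms m) (allFin (suc m)) x∈
  ... | τ , p , τ∈ , _ , refl = ∈-Perms⁺ (unique-insertMax⁺ τ p (∈-Perms⁻ τ∈))

R-suc : ∀ {L} → Linear L →
  (∀ (τ : Vec (Fin m) m) →
     generating (map desE (tabulate (insertMax τ))) ≗ L (monomial (desE τ))) →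
  R (suc m) ≗ L (R m)
R-suc {m} {L} lin insert≗ k = begin
  R (suc m) k
    ≡⟨ R-generating (suc m) k ⟩
  generating (map desE (Perms (suc m))) k
    ≡⟨ generating-↭ (PermutationP.map⁺ desE (Perms-suc-↭ {m})) k ⟩
  generating (map desE (concatMap (tabulate ∘ insertMax) (Perms m))) k
    ≡⟨ cong (λ ds → generating ds k) (ListP.map-concatMap desE (tabulate ∘ insertMax) (Perms m)) ⟩
  generating (concatMap (map desE ∘ tabulate ∘ insertMax) (Perms m)) k
    ≡⟨ generating-concatMap lin (map desE ∘ tabulate ∘ insertMax) desE insert≗ (Perms m) k ⟩
  L (generating (map desE (Perms m))) k
    ≡⟨ Linear.≗-cong lin (λ j → sym (R-generating m j)) k ⟩
  L (R m) k
    ∎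
  where open ≡-Reasoning

R-suc-odd : evenBit (suc m) ≡ 0 → R (suc m) ≗ Δ m (R m)
R-suc-odd {m} odd = R-suc Δ-linear λ τ k → begin
  generating (map desE (tabulate (insertMax τ))) k  ≡⟨ generating-insertMax τ k ⟩
  Δ m (monomial (desE τ + evenBit (suc m))) k      ≡⟨ cong (λ b → Δ m (monomial (desE τ + b)) k) odd ⟩
  Δ m (monomial (desE τ + 0)) k                    ≡⟨ cong (λ d → Δ m (monomial d) k) (+-identityʳ (desE τ)) ⟩
  Δ m (monomial (desE τ)) k                        ∎
  where open ≡-Reasoning

R-suc-even : evenBit (suc m) ≡ 1 → R (suc m) ≗ Γ m (R m)
R-suc-even {m} even = R-suc Γ-linear λ τ k → begin
  generating (map desE (tabulate (insertMax τ))) k  ≡⟨ generating-insertMax τ k ⟩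
  Δ m (monomial (desE τ + evenBit (suc m))) k      ≡⟨ cong (λ b → Δ m (monomial (desE τ + b)) k) even ⟩
  Δ m (monomial (desE τ + 1)) k                    ≡⟨ cong (λ d → Δ m (monomial d) k) (+-comm (desE τ) 1) ⟩
  Δ m (monomial (suc (desE τ))) k                  ≡⟨ Δ-monomial-suc≗Γ-monomial (desE τ) k ⟩
  Γ m (monomial (desE τ)) k                        ∎
  where open ≡-Reasoning

evenBit-periodic : ∀ r n → evenBit (r + n * 2) ≡ evenBit r
evenBit-periodic r n = cong (λ x → if x ≡ᵇ 0 then 1 else 0) ([m+kn]%n≡m%n r n 2)

R-odd : ∀ n → R (2 * n + 1) ≗ Δ (2 * n) (R (2 * n))
R-odd n rewrite +-comm (2 * n) 1 =
  R-suc-odd {2 * n} (trans (cong (λ x → evenBit (1 + x)) (*-comm 2 n)) (evenBit-periodic 1 n))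

R-even : ∀ n → R (2 * n + 2) ≗ Γ (2 * n + 1) (R (2 * n + 1))
R-even n rewrite +-suc (2 * n) 1 =
  R-suc-even {2 * n + 1} (trans (cong evenBit 2n+2≡2+n*2) (evenBit-periodic 2 n))
  where
  2n+2≡2+n*2 : suc (2 * n + 1) ≡ 2 + n * 2
  2n+2≡2+n*2 = cong suc (trans (+-comm (2 * n) 1) (cong suc (*-comm 2 n)))

R-1 : ∀ k → R 1 k ≡ one k
R-1 zero    = refl
R-1 (suc k) = refl

R-2 : ∀ k → R 2 k ≡ onePlusX k
R-2 zero          = refl
R-2 (suc zero)    = refl
R-2 (suc (suc k)) = refl

-- The recurrences hold for n = 0 as well.
theorem3p1 : ((∀ k → R 1 k ≡ one k) × (∀ k → R 2 k ≡ onePlusX k))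
    × (∀ (n : ℕ) → 1 ≤ n → ∀ k → R (2 * n + 1) k ≡ Δ (2 * n) (R (2 * n)) k)
    × (∀ (n : ℕ) → 1 ≤ n → ∀ k → R (2 * n + 2) k ≡ Γ (2 * n + 1) (R (2 * n + 1)) k)
theorem3p1 = (R-1 , R-2) , (λ n _ → R-odd n) , (λ n _ → R-even n)
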